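{- Let $\varphi$ be a $\mathrm{D}$-formula and $\mathcal{G}=(\mathbb{P}_\mathbb{S},\mathcal{L})$ a weak compass $\varphi$-structure over a finite linear order $\mathbb{S}=(S,<)$, $S=\{0,\dots,N\}$, such that $\mathcal{R}eq_D(\mathcal{L}(x,x))=\emptyset$ for all $x\in S$. Then $\mathcal{G}$ is a homogeneous fulfilling compass $\varphi$-structure if and only if for every $0\le y<|S|-1$, $row_{y+1}=succ_\varphi(row_y,row_{y+1}[0])$, where $row_y$ denotes the sequence $\mathcal{L}(y,y)\mathcal{L}(y-1,y)\cdots\mathcal{L}(0,y)$.
   Context: Formulas: $\varphi ::= p\mid\neg\varphi\mid\varphi\vee\varphi\mid\langle D\rangle\varphi$, $p\in\mathcal{AP}$; $[D]\psi:=\neg\langle D\rangle\neg\psi$. $\mathrm{CL}(\varphi)$: subformulas and their negations, identifying $\neg\neg\psi$ with $\psi$ and $\neg\langle D\rangle\psi$ with $[D]\neg\psi$. A $\varphi$-atom is $A\subseteq\mathrm{CL}(\varphi)$ with $\psi\in A$ iff $\neg\psi\notin A$, and $\psi_1\vee\psi_2\in A$ iff $\psi_1\in A$ or $\psi_2\in A$. $\mathcal{R}eq_D(A)=\{\psi:\langle D\rangle\psi\in A\}$, $\mathrm{REQ}_\varphi=\{\psi:\langle D\rangle\psi\in\mathrm{CL}(\varphi)\}$, $\mathcal{O}bs_D(A)=A\cap\mathrm{REQ}_\varphi$. $A\,D_\varphi\,A'$ iff for every $[D]\psi\in A$, $\psi\in A'$ and $[D]\psi\in A'$. $A_1A_2\Rightarrow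 A_3$ iff $A_3\cap\mathcal{AP}=A_1\cap A_2\cap\mathcal{AP}$ and $\mathcal{R}eq_D(A_3)=\mathcal{R}eq_D(A_1)\cup\mathcal{R}eq_D(A_2)\cup\mathcal{O}bs_D(A_1)\cup\mathcal{O}bs_D(A_2)$. For a sequence $row$ of atoms of length $n$ and an atom $A$, $succ_\varphi(row,A)=B_0\cdots B_n$ with $B_0=A$ and $row[i]B_i\Rightarrow B_{i+1}$. $\mathbb{P}_\mathbb{S}=\{(x,y):x\le y\}$; $(x',y')\sqsubset(x,y)$ iff $x\le x'$, $y'\le y$, $(x',y')\ne(x,y)$. A weak compass $\varphi$-structure is $(\mathbb{P}_\mathbb{S},\mathcal{L})$ with $\mathcal{L}$ mapping points to $\varphi$-atoms; it is a compass structure if $(x',y')\sqsubset(x,y)$ implies $\mathcal{L}(x,y)\,D_\varphi\,\mathcal{L}(x',y')$; fulfilling if each $\psi\in\mathcal{R}eq_D(\mathcal{L}(x,y))$ lies in $\mathcal{L}(x',y')$ for some $(x',y')\sqsubset(x,y)$; homogeneous if $p\in\mathcal{L}(x,y)$ iff $p\in\mathcal{L}(x',x')$ for all $x'\in[x,y]$, for all $p\in\mathcal{AP}$. -}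

module Defs where

open import Data.Nat using (ℕ; zero; suc; _≤_; _<_; _∸_)
open import Data.Bool using (Bool; true; false; _∧_; _∨_; not)
open import Data.Product using (Σ; ∃; _×_; _,_)
open import Data.Sum using (_⊎_)
open import Relation.Binary.PropositionalEquality using (_≡_; _≢_)
open import Relation.Nullary using (¬_)
open import Function.Bundles using (_⇔_)

data Formula : Set where
  atom : ℕ → Formula
  neg  : Formula → Formula
  or   : Formula → Formula → Formula
  dia  : Formula → Formula

-- "smart" negation implementing the identification ¬¬ψ = ψ
~_ : Formula → Formula
~ neg ψ    = ψ
~ atom p   = neg (atom p)
~ or a b   = neg (or a b)
~ dia a    = neg (dia a)

-- normal form: all double negations removed (representatives of the
-- identification classes)
nf : Formula → Formula
nf (atom p) = atom p
nf (neg ψ)  = ~ nf ψ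
nf (or a b) = or (nf a) (nf b)
nf (dia a)  = dia (nf a)

box : Formula → Formula
box ψ = ~ dia (~ ψ)

data Sub : Formula → Formula → Set where
  sub-refl : ∀ {φ} → Sub φ φ
  sub-neg  : ∀ {ψ φ} → Sub ψ φ → Sub ψ (neg φ)
  sub-orl  : ∀ {ψ a b} → Sub ψ a → Sub ψ (or a b)
  sub-orr  : ∀ {ψ a b} → Sub ψ b → Sub ψ (or a b)
  sub-dia  : ∀ {ψ φ} → Sub ψ φ → Sub ψ (dia φ)

-- CL(φ): subformulas and their negations, modulo the identifications
-- (represented by normal forms)
InCL : Formula → Formula → Set
InCL φ ψ = Σ Formula λ χ → Sub χ φ × (ψ ≡ nf χ ⊎ ψ ≡ ~ nf χ)

FSet : Set
FSet = Formula → Bool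

record IsAtom (φ : Formula) (A : FSet) : Set where
  field
    ⊆CL  : ∀ ψ → A ψ ≡ true → InCL φ ψ
    negC : ∀ ψ → InCL φ ψ → A ψ ≡ not (A (~ ψ))
    orC  : ∀ a b → InCL φ (or a b) → A (or a b) ≡ A a ∨ A b

-- ψ ∈ Req_D(A)  iff  ⟨D⟩ψ ∈ A
-- ψ ∈ REQ_φ     iff  ⟨D⟩ψ ∈ CL(φ)
-- Obs_D(A) = A ∩ REQ_φ

-- A D_φ A' : for every [D]ψ ∈ A, ψ ∈ A' and [D]ψ ∈ A'.
-- Every element of the form [D]ψ of CL(φ) is  neg (dia χ)  with ψ = ~ χ.
DRel : FSet → FSet → Set
DRel A A' = ∀ χ → A (neg (dia χ)) ≡ true →
            (A' (~ χ) ≡ true) × (A' (neg (dia χ)) ≡ true)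

Imp : Formula → FSet → FSet → FSet → Set
Imp φ A₁ A₂ A₃ =
  (∀ p → A₃ (atom p) ≡ (A₁ (atom p) ∧ A₂ (atom p))) ×
  (∀ ψ → (A₃ (dia ψ) ≡ true) ⇔
           ((A₁ (dia ψ) ≡ true) ⊎ (A₂ (dia ψ) ≡ true)
            ⊎ ((A₁ ψ ≡ true) × InCL φ (dia ψ))
            ⊎ ((A₂ ψ ≡ true) × InCL φ (dia ψ))))

-- Structures over S = {0,…,N};  P_S = {(x,y) : x ≤ y ≤ N}

Labelling : Set
Labelling = ℕ → ℕ → FSet

_⊏_ : ℕ × ℕ → ℕ × ℕ → Set
(x' , y') ⊏ (x , y) = x ≤ x' × y' ≤ y × (x' , y') ≢ (x , y)

WeakCompass : Formula → ℕ → Labelling → Set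
WeakCompass φ N L = ∀ x y → x ≤ y → y ≤ N → IsAtom φ (L x y)

IsCompass : ℕ → Labelling → Set
IsCompass N L = ∀ x y x' y' → x ≤ y → y ≤ N → x' ≤ y' →
  (x' , y') ⊏ (x , y) → DRel (L x y) (L x' y')

Fulfilling : ℕ → Labelling → Set
Fulfilling N L = ∀ x y → x ≤ y → y ≤ N → ∀ ψ → L x y (dia ψ) ≡ true →
  Σ ℕ λ x' → Σ ℕ λ y' → x' ≤ y' × (x' , y') ⊏ (x , y) × L x' y' ψ ≡ true

Homogeneous : ℕ → Labelling → Set
Homogeneous N L = ∀ x y → x ≤ y → y ≤ N → ∀ p →
  (L x y (atom p) ≡ true) ⇔ (∀ x' → x ≤ x' → x' ≤ y → L x' x' (atom p) ≡ true)

-- row_y = L(y,y) L(y-1,y) ⋯ L(0,y), as a sequence indexed by 0..y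
row : Labelling → ℕ → ℕ → FSet
row L y i = L (y ∸ i) y

-- IsSucc φ n r A B :  B₀ ⋯ Bₙ = succ_φ(r , A)  where r has length n,
-- i.e. B₀ = A and r[i] B_i ⇒ B_{i+1} for all i < n.
-- (B₀ = A is stated pointwise.)
IsSucc : Formula → ℕ → (ℕ → FSet) → FSet → (ℕ → FSet) → Set
IsSucc φ n r A B = (∀ ψ → B 0 ψ ≡ A ψ) × (∀ i → i < n → Imp φ (r i) (B i) (B (suc i)))

module Submission where

-- For φ-atoms, A D_φ B holds exactly when Req_D(B) ∪ Obs_D(B) ⊆ Req_D(A). Every proper
-- subinterval of [x, y+1] lies within [x, y] or within [x+1, y+1], so in a homogeneous
-- fulfilling compass structure each label L(x, y+1) is the ⇒-successor of L(x, y) and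
-- L(x+1, y+1); entry by entry, this is the row condition. Conversely, if every label is
-- such a successor, the compass, homogeneity and fulfilment conditions propagate from the
-- points, where Req_D is empty, to all intervals by induction on the length of the interval.

open import Defs
open import Data.Nat using (ℕ; zero; suc; _≤_; _<_; _∸_; _+_; _≟_; _≤?_; s≤s)
open import Data.Nat.Properties
open import Data.Empty using (⊥-elim)
open import Data.Bool using (true; false; _∧_; not)
open import Data.Bool.Properties using (not-injective; ¬-not)
open import Data.Product using (_×_; _,_; Σ; proj₁; proj₂; map₁; map₂)
open import Data.Product.Properties using (≡-dec)
open import Data.Product.Function.NonDependent.Propositional using (_×-⇔_)
open import Data.Sum using (_⊎_; inj₁; inj₂; [_,_]′)
open import Function using (_∘_; id)
open import Function.Bundles using (_⇔_; mk⇔; Equivalence)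
open import Function.Properties.Equivalence using () renaming (sym to ⇔-sym; trans to ⇔-trans)
open import Relation.Nullary using (¬_; yes; no)
open import Relation.Binary.PropositionalEquality

open Equivalence using (to; from)

sub-trans : ∀ {a b c} → Sub a b → Sub b c → Sub a c
sub-trans s sub-refl    = s
sub-trans s (sub-neg t) = sub-neg (sub-trans s t)
sub-trans s (sub-orl t) = sub-orl (sub-trans s t)
sub-trans s (sub-orr t) = sub-orr (sub-trans s t)
sub-trans s (sub-dia t) = sub-dia (sub-trans s t)

~~-nf : ∀ χ → ~ ~ nf χ ≡ nf χ
~~-nf (atom p) = refl
~~-nf (neg χ)  = cong ~_ (~~-nf χ)
~~-nf (or a b) = refl
~~-nf (dia a)  = refl

InCL-~ : ∀ {φ ψ} → InCL φ ψ → InCL φ (~ ψ)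
InCL-~ (χ , s , inj₁ refl) = χ , s , inj₂ refl
InCL-~ (χ , s , inj₂ refl) = χ , s , inj₁ (~~-nf χ)

dia-nf⇒sub : ∀ {ψ} θ → dia ψ ≡ nf θ ⊎ dia ψ ≡ ~ nf θ →
  Σ Formula λ θ' → Sub θ' θ × ψ ≡ nf θ'
dia-nf⇒sub (atom p) (inj₁ ())
dia-nf⇒sub (atom p) (inj₂ ())
dia-nf⇒sub (neg θ) (inj₁ e) = map₂ (map₁ sub-neg) (dia-nf⇒sub θ (inj₂ e))
dia-nf⇒sub (neg θ) (inj₂ e) = map₂ (map₁ sub-neg) (dia-nf⇒sub θ (inj₁ (trans e (~~-nf θ))))
dia-nf⇒sub (or a b) (inj₁ ())
dia-nf⇒sub (or a b) (inj₂ ())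
dia-nf⇒sub (dia a) (inj₁ refl) = a , sub-dia sub-refl , refl
dia-nf⇒sub (dia a) (inj₂ ())

InCL-dia : ∀ {φ ψ} → InCL φ (dia ψ) → InCL φ ψ
InCL-dia (θ , s , e) with dia-nf⇒sub θ e
... | θ' , s' , e' = θ' , sub-trans s' s , inj₁ e'

∧-≡-true⇔ : ∀ {a b} → (a ∧ b ≡ true) ⇔ (a ≡ true × b ≡ true)
∧-≡-true⇔ {true}  = mk⇔ (refl ,_) proj₂
∧-≡-true⇔ {false} = mk⇔ (λ ()) (λ { (() , _) })

≡⇒≡-true⇔ : ∀ {a b} → a ≡ b → (a ≡ true) ⇔ (b ≡ true)
≡⇒≡-true⇔ a≡b = mk⇔ (trans (sym a≡b)) (trans a≡b)

≡-true⇔⇒≡ : ∀ {a b} → (a ≡ true) ⇔ (b ≡ true) → a ≡ b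
≡-true⇔⇒≡ {true}          a⇔b = sym (to a⇔b refl)
≡-true⇔⇒≡ {false} {false} a⇔b = refl
≡-true⇔⇒≡ {false} {true}  a⇔b with from a⇔b refl
... | ()

module _ {φ A} (a : IsAtom φ A) {ψ} (cl : InCL φ ψ) where
  open IsAtom a

  ∉⇒~∈ : A ψ ≢ true → A (~ ψ) ≡ true
  ∉⇒~∈ ψ∉ = not-injective (trans (sym (negC ψ cl)) (¬-not ψ∉))

  ~∉⇒∈ : A (~ ψ) ≢ true → A ψ ≡ true
  ~∉⇒∈ ~ψ∉ = trans (negC ψ cl) (cong not (¬-not ~ψ∉))

  ~∈⇒∉ : A (~ ψ) ≡ true → A ψ ≢ true
  ~∈⇒∉ ~ψ∈ ψ∈ with trans (sym ψ∈) (trans (negC ψ cl) (cong not ~ψ∈))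
  ... | ()

DRel-trans : ∀ {A B C} → DRel A B → DRel B C → DRel A C
DRel-trans AB BC χ □¬χ = BC χ (proj₂ (AB χ □¬χ))

module _ {φ A B} (a : IsAtom φ A) (b : IsAtom φ B) (AB : DRel A B) where

  req-mono : ∀ {ψ} → B (dia ψ) ≡ true → A (dia ψ) ≡ true
  req-mono {ψ} ◇ψ = ~∉⇒∈ a cl (λ □¬ψ → ~∈⇒∉ b cl (proj₂ (AB ψ □¬ψ)) ◇ψ)
    where cl = IsAtom.⊆CL b (dia ψ) ◇ψ

  obs⊆req : ∀ {ψ} → InCL φ (dia ψ) → B ψ ≡ true → A (dia ψ) ≡ true
  obs⊆req {ψ} cl ψ∈ = ~∉⇒∈ a cl (λ □¬ψ → ~∈⇒∉ b (InCL-dia cl) (proj₁ (AB ψ □¬ψ)) ψ∈)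

DRel-intro : ∀ {φ A B} → IsAtom φ A → IsAtom φ B →
  (∀ {ψ} → B (dia ψ) ≡ true → A (dia ψ) ≡ true) →
  (∀ {ψ} → InCL φ (dia ψ) → B ψ ≡ true → A (dia ψ) ≡ true) → DRel A B
DRel-intro {φ} {A} a b req obs χ □¬χ =
  ∉⇒~∈ b (InCL-dia cl) (◇χ∉ ∘ obs cl) , ∉⇒~∈ b cl (◇χ∉ ∘ req)
  where
  cl : InCL φ (dia χ)
  cl = InCL-~ (IsAtom.⊆CL a (neg (dia χ)) □¬χ)
  ◇χ∉ : A (dia χ) ≢ true
  ◇χ∉ = ~∈⇒∉ a cl □¬χ

_⊑_ : ℕ × ℕ → ℕ × ℕ → Set
p ⊑ q = p ≡ q ⊎ p ⊏ q

⊑-intro : ∀ {x y x' y'} → x ≤ x' → y' ≤ y → (x' , y') ⊑ (x , y)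
⊑-intro {x} {y} {x'} {y'} x≤x' y'≤y with ≡-dec _≟_ _≟_ (x' , y') (x , y)
... | yes eq = inj₁ eq
... | no  ne = inj₂ (x≤x' , y'≤y , ne)

⊏-point-empty : ∀ {x x' y'} → x' ≤ y' → ¬ ((x' , y') ⊏ (x , x))
⊏-point-empty x'≤y' (x≤x' , y'≤x , ne) =
  ne (cong₂ _,_ (≤-antisym (≤-trans x'≤y' y'≤x) x≤x') (≤-antisym y'≤x (≤-trans x≤x' x'≤y')))

⊏-left : ∀ {x y x' y'} → x ≤ x' → y' ≤ y → (x' , y') ⊏ (x , suc y)
⊏-left x≤x' y'≤y = x≤x' , m≤n⇒m≤1+n y'≤y , λ e → <⇒≢ (s≤s y'≤y) (cong proj₂ e)

⊏-right : ∀ {x y x' y'} → suc x ≤ x' → y' ≤ suc y → (x' , y') ⊏ (x , suc y)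
⊏-right x<x' y'≤sy = <⇒≤ x<x' , y'≤sy , λ e → <⇒≢ x<x' (sym (cong proj₁ e))

⊏-split : ∀ {x y x' y'} → (x' , y') ⊏ (x , suc y) →
  (x ≤ x' × y' ≤ y) ⊎ (suc x ≤ x' × y' ≤ suc y)
⊏-split {x} {y} {x'} {y'} (x≤x' , y'≤sy , ne) with y' ≤? y
... | yes y'≤y = inj₁ (x≤x' , y'≤y)
... | no  y'≰y = inj₂ (≤∧≢⇒< x≤x' x≢x' , y'≤sy)
  where
  x≢x' : x ≢ x'
  x≢x' x≡x' = ne (cong₂ _,_ (sym x≡x') (≤-antisym y'≤sy (≰⇒> y'≰y)))

interval-split : ∀ {ℓ} {P : ℕ → Set ℓ} {x y} → x ≤ y →
  (∀ z → x ≤ z → z ≤ suc y → P z) ⇔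
  ((∀ z → x ≤ z → z ≤ y → P z) × (∀ z → suc x ≤ z → z ≤ suc y → P z))
interval-split {P = P} {x} {y} x≤y = mk⇔
  (λ all → (λ z x≤z z≤y → all z x≤z (m≤n⇒m≤1+n z≤y)) , (λ z x<z → all z (<⇒≤ x<z)))
  join
  where
  join : (∀ z → x ≤ z → z ≤ y → P z) × (∀ z → suc x ≤ z → z ≤ suc y → P z) →
         ∀ z → x ≤ z → z ≤ suc y → P z
  join (left , right) z x≤z z≤sy with z ≤? y
  ... | yes z≤y = left z x≤z z≤y
  ... | no  z≰y = right z (≤-trans (s≤s x≤y) (≰⇒> z≰y)) z≤sy

interval-induction : ∀ {ℓ} (N : ℕ) (P : ℕ → ℕ → Set ℓ) →
  (∀ {x} → x ≤ N → P x x) →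
  (∀ {x y} → x ≤ y → y < N → P x y → P (suc x) (suc y) → P x (suc y)) →
  ∀ {x y} → x ≤ y → y ≤ N → P x y
interval-induction N P base step {x} {y} x≤y y≤N =
  subst (P x) (m∸n+n≡m x≤y) (by-length (y ∸ x) x (subst (_≤ N) (sym (m∸n+n≡m x≤y)) y≤N))
  where
  by-length : ∀ d x → d + x ≤ N → P x (d + x)
  by-length zero    x x≤N = base x≤N
  by-length (suc d) x d+x<N = step (m≤n+m x d) d+x<N (by-length d x (<⇒≤ d+x<N))
    (subst (P (suc x)) (+-suc d x) (by-length d (suc x) (subst (_≤ N) (sym (+-suc d x)) d+x<N)))

ReqObs : Formula → FSet → FSet → Formula → Set
ReqObs φ A₁ A₂ ψ =
  (A₁ (dia ψ) ≡ true) ⊎ (A₂ (dia ψ) ≡ true)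
  ⊎ ((A₁ ψ ≡ true) × InCL φ (dia ψ)) ⊎ ((A₂ ψ ≡ true) × InCL φ (dia ψ))

SuccAt : Formula → Labelling → ℕ → ℕ → Set
SuccAt φ L x y = Imp φ (L x y) (L (suc x) (suc y)) (L x (suc y))

LocalSucc : Formula → ℕ → Labelling → Set
LocalSucc φ N L = ∀ {x y} → x ≤ y → y < N → SuccAt φ L x y

HomogeneousAt : Labelling → ℕ → ℕ → Set
HomogeneousAt L x y = ∀ p →
  (L x y (atom p) ≡ true) ⇔ (∀ x' → x ≤ x' → x' ≤ y → L x' x' (atom p) ≡ true)

Witness : Labelling → ℕ → ℕ → Formula → Set
Witness L x y ψ = Σ ℕ λ x' → Σ ℕ λ y' → x' ≤ y' × (x' , y') ⊏ (x , y) × L x' y' ψ ≡ true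

FulfilledAt : Labelling → ℕ → ℕ → Set
FulfilledAt L x y = ∀ ψ → L x y (dia ψ) ≡ true → Witness L x y ψ

CompassAt : Labelling → ℕ → ℕ → Set
CompassAt L x y = ∀ x' y' → x' ≤ y' → (x' , y') ⊏ (x , y) → DRel (L x y) (L x' y')

Witness-mono : ∀ {L a b c d ψ} → (∀ {x' y'} → (x' , y') ⊏ (a , b) → (x' , y') ⊏ (c , d)) →
  Witness L a b ψ → Witness L c d ψ
Witness-mono ⊏⇒⊏ (x' , y' , x'≤y' , sq , ψ∈) = x' , y' , x'≤y' , ⊏⇒⊏ sq , ψ∈

homogeneous-children : ∀ {L x y} → x ≤ y →
  HomogeneousAt L x y → HomogeneousAt L (suc x) (suc y) → ∀ p →
  (L x y (atom p) ∧ L (suc x) (suc y) (atom p) ≡ true) ⇔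
  (∀ x' → x ≤ x' → x' ≤ suc y → L x' x' (atom p) ≡ true)
homogeneous-children x≤y left right p =
  ⇔-trans ∧-≡-true⇔ (⇔-trans (left p ×-⇔ right p) (⇔-sym (interval-split x≤y)))

DRel-⊑ : ∀ {A L a b x' y'} → DRel A (L a b) → CompassAt L a b →
  x' ≤ y' → (x' , y') ⊑ (a , b) → DRel A (L x' y')
DRel-⊑ A⇒ab _ _ (inj₁ refl) = A⇒ab
DRel-⊑ {A} {L} {a} {b} {x'} {y'} A⇒ab compass x'≤y' (inj₂ sq) =
  DRel-trans {A} {L a b} {L x' y'} A⇒ab (compass x' y' x'≤y' sq)

row-step≡SuccAt : ∀ {φ L y i} → i ≤ y →
  Imp φ (row L y i) (row L (suc y) i) (row L (suc y) (suc i)) ≡ SuccAt φ L (y ∸ i) y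
row-step≡SuccAt {φ} {L} {y} {i} i≤y =
  cong (λ x₁ → Imp φ (L (y ∸ i) y) (L x₁ (suc y)) (L (y ∸ i) (suc y))) (+-∸-assoc 1 i≤y)

RowsSucc : Formula → ℕ → Labelling → Set
RowsSucc φ N L = ∀ y → y < N → IsSucc φ (suc y) (row L y) (row L (suc y) 0) (row L (suc y))

rows-succ⇔local-succ : ∀ φ N L → RowsSucc φ N L ⇔ LocalSucc φ N L
rows-succ⇔local-succ φ N L = mk⇔ rows⇒local local⇒rows
  where
  rows⇒local : RowsSucc φ N L → LocalSucc φ N L
  rows⇒local rows {x} {y} x≤y y<N =
    subst (λ x₀ → SuccAt φ L x₀ y) (m∸[m∸n]≡n x≤y)
      (subst id (row-step≡SuccAt {φ} {L} (m∸n≤m y x)) (proj₂ (rows y y<N) (y ∸ x) (s≤s (m∸n≤m y x))))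
  local⇒rows : LocalSucc φ N L → RowsSucc φ N L
  local⇒rows local y y<N = (λ _ → refl) , λ i i≤y →
    subst id (sym (row-step≡SuccAt {φ} {L} (≤-pred i≤y))) (local (m∸n≤m y i) y<N)

module Structure (φ : Formula) (N : ℕ) (L : Labelling) where

  compass⇒⊑-witness : WeakCompass φ N L → IsCompass N L →
    ∀ {a b x' y' ψ} → a ≤ b → b ≤ N → x' ≤ y' → (x' , y') ⊑ (a , b) →
    InCL φ (dia ψ) → L x' y' ψ ≡ true → L a b (dia ψ) ≡ true ⊎ L a b ψ ≡ true
  compass⇒⊑-witness _ _ _ _ _ (inj₁ refl) _ ψ∈ = inj₂ ψ∈
  compass⇒⊑-witness W C a≤b b≤N x'≤y' (inj₂ sq) cl ψ∈ =
    inj₁ (obs⊆req (W _ _ a≤b b≤N) (W _ _ x'≤y' (≤-trans (proj₁ (proj₂ sq)) b≤N))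
                  (C _ _ _ _ a≤b b≤N x'≤y' sq) cl ψ∈)

  compass-homogeneous-fulfilling⇒local-succ : WeakCompass φ N L →
    IsCompass N L → Homogeneous N L → Fulfilling N L → LocalSucc φ N L
  compass-homogeneous-fulfilling⇒local-succ W C H F {x} {y} x≤y y<N =
    atoms , λ ψ → mk⇔ (fulfilled ψ) introduced
    where
    y≤N  = <⇒≤ y<N
    x≤sy = m≤n⇒m≤1+n x≤y
    top   = W x (suc y) x≤sy y<N
    left  = W x y x≤y y≤N
    right = W (suc x) (suc y) (s≤s x≤y) y<N

    top⇒left : DRel (L x (suc y)) (L x y)
    top⇒left = C x (suc y) x y x≤sy y<N x≤y (⊏-left ≤-refl ≤-refl)
    top⇒right : DRel (L x (suc y)) (L (suc x) (suc y))
    top⇒right = C x (suc y) (suc x) (suc y) x≤sy y<N (s≤s x≤y) (⊏-right ≤-refl ≤-refl)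

    atoms : ∀ p → L x (suc y) (atom p) ≡ (L x y (atom p) ∧ L (suc x) (suc y) (atom p))
    atoms p = ≡-true⇔⇒≡ (⇔-trans (H x (suc y) x≤sy y<N p)
      (⇔-sym (homogeneous-children {L} x≤y (H x y x≤y y≤N) (H (suc x) (suc y) (s≤s x≤y) y<N) p)))

    introduced : ∀ {ψ} → ReqObs φ (L x y) (L (suc x) (suc y)) ψ → L x (suc y) (dia ψ) ≡ true
    introduced (inj₁ ◇ψ)                    = req-mono top left top⇒left ◇ψ
    introduced (inj₂ (inj₁ ◇ψ))             = req-mono top right top⇒right ◇ψ
    introduced (inj₂ (inj₂ (inj₁ (ψ∈ , cl)))) = obs⊆req top left top⇒left cl ψ∈
    introduced (inj₂ (inj₂ (inj₂ (ψ∈ , cl)))) = obs⊆req top right top⇒right cl ψ∈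

    fulfilled : ∀ ψ → L x (suc y) (dia ψ) ≡ true → ReqObs φ (L x y) (L (suc x) (suc y)) ψ
    fulfilled ψ ◇ψ with F x (suc y) x≤sy y<N ψ ◇ψ
    ... | x' , y' , x'≤y' , sq , ψ∈ = [ via-left , via-right ]′ (⊏-split sq)
      where
      cl = IsAtom.⊆CL top (dia ψ) ◇ψ
      via-left : x ≤ x' × y' ≤ y → ReqObs φ (L x y) (L (suc x) (suc y)) ψ
      via-left (x≤x' , y'≤y) = [ inj₁ , (λ ψ∈ → inj₂ (inj₂ (inj₁ (ψ∈ , cl)))) ]′
        (compass⇒⊑-witness W C x≤y y≤N x'≤y' (⊑-intro x≤x' y'≤y) cl ψ∈)
      via-right : suc x ≤ x' × y' ≤ suc y → ReqObs φ (L x y) (L (suc x) (suc y)) ψ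
      via-right (x<x' , y'≤sy) = [ inj₂ ∘ inj₁ , (λ ψ∈ → inj₂ (inj₂ (inj₂ (ψ∈ , cl)))) ]′
        (compass⇒⊑-witness W C (s≤s x≤y) y<N x'≤y' (⊑-intro x<x' y'≤sy) cl ψ∈)

  local-succ⇒homogeneous : LocalSucc φ N L → Homogeneous N L
  local-succ⇒homogeneous S x y = interval-induction N (HomogeneousAt L) (λ _ → point) step
    where
    point : ∀ {x} → HomogeneousAt L x x
    point {x} p = mk⇔
      (λ p∈ x' x≤x' x'≤x → subst (λ z → L z z (atom p) ≡ true) (≤-antisym x≤x' x'≤x) p∈)
      (λ all → all x ≤-refl ≤-refl)
    step : ∀ {x y} → x ≤ y → y < N →
      HomogeneousAt L x y → HomogeneousAt L (suc x) (suc y) → HomogeneousAt L x (suc y)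
    step x≤y y<N left right p =
      ⇔-trans (≡⇒≡-true⇔ (proj₁ (S x≤y y<N) p)) (homogeneous-children {L} x≤y left right p)

  local-succ⇒fulfilling : (∀ x → x ≤ N → ∀ ψ → L x x (dia ψ) ≡ false) →
    LocalSucc φ N L → Fulfilling N L
  local-succ⇒fulfilling no-req S x y = interval-induction N (FulfilledAt L) point step
    where
    point : ∀ {x} → x ≤ N → FulfilledAt L x x
    point {x} x≤N ψ ◇ψ with trans (sym ◇ψ) (no-req x x≤N ψ)
    ... | ()
    step : ∀ {x y} → x ≤ y → y < N →
      FulfilledAt L x y → FulfilledAt L (suc x) (suc y) → FulfilledAt L x (suc y)
    step {x} {y} x≤y y<N left right ψ ◇ψ with to (proj₂ (S x≤y y<N) ψ) ◇ψ
    ... | inj₁ ◇ψ =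
      Witness-mono {L} {ψ = ψ} (λ (x≤x' , y'≤y , _) → ⊏-left x≤x' y'≤y) (left ψ ◇ψ)
    ... | inj₂ (inj₁ ◇ψ) =
      Witness-mono {L} {ψ = ψ} (λ (x<x' , y'≤sy , _) → ⊏-right x<x' y'≤sy) (right ψ ◇ψ)
    ... | inj₂ (inj₂ (inj₁ (ψ∈ , _))) = x , y , x≤y , ⊏-left ≤-refl ≤-refl , ψ∈
    ... | inj₂ (inj₂ (inj₂ (ψ∈ , _))) = suc x , suc y , s≤s x≤y , ⊏-right ≤-refl ≤-refl , ψ∈

  local-succ⇒DRel-left : WeakCompass φ N L → LocalSucc φ N L →
    ∀ {x y} → x ≤ y → y < N → DRel (L x (suc y)) (L x y)
  local-succ⇒DRel-left W S x≤y y<N =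
    DRel-intro (W _ _ (m≤n⇒m≤1+n x≤y) y<N) (W _ _ x≤y (<⇒≤ y<N))
      (λ ◇ψ → from (proj₂ (S x≤y y<N) _) (inj₁ ◇ψ))
      (λ cl ψ∈ → from (proj₂ (S x≤y y<N) _) (inj₂ (inj₂ (inj₁ (ψ∈ , cl)))))

  local-succ⇒DRel-right : WeakCompass φ N L → LocalSucc φ N L →
    ∀ {x y} → x ≤ y → y < N → DRel (L x (suc y)) (L (suc x) (suc y))
  local-succ⇒DRel-right W S x≤y y<N =
    DRel-intro (W _ _ (m≤n⇒m≤1+n x≤y) y<N) (W _ _ (s≤s x≤y) y<N)
      (λ ◇ψ → from (proj₂ (S x≤y y<N) _) (inj₂ (inj₁ ◇ψ)))
      (λ cl ψ∈ → from (proj₂ (S x≤y y<N) _) (inj₂ (inj₂ (inj₂ (ψ∈ , cl)))))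

  local-succ⇒compass : WeakCompass φ N L → LocalSucc φ N L → IsCompass N L
  local-succ⇒compass W S x y x' y' x≤y y≤N =
    interval-induction N (CompassAt L) point step x≤y y≤N x' y'
    where
    point : ∀ {x} → x ≤ N → CompassAt L x x
    point _ _ _ x'≤y' sq = ⊥-elim (⊏-point-empty x'≤y' sq)
    step : ∀ {x y} → x ≤ y → y < N →
      CompassAt L x y → CompassAt L (suc x) (suc y) → CompassAt L x (suc y)
    step {x} {y} x≤y y<N left right x' y' x'≤y' sq with ⊏-split sq
    ... | inj₁ (x≤x' , y'≤y) =
      DRel-⊑ {L x (suc y)} {L} (local-succ⇒DRel-left W S x≤y y<N) left x'≤y' (⊑-intro x≤x' y'≤y)
    ... | inj₂ (x<x' , y'≤sy) =
      DRel-⊑ {L x (suc y)} {L} (local-succ⇒DRel-right W S x≤y y<N) right x'≤y' (⊑-intro x<x' y'≤sy)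

lemma3p9 : (φ : Formula) (N : ℕ) (L : Labelling) →
    WeakCompass φ N L →
    (∀ x → x ≤ N → ∀ ψ → L x x (dia ψ) ≡ false) →
    (IsCompass N L × Homogeneous N L × Fulfilling N L)
      ⇔ (∀ y → y < N → IsSucc φ (suc y) (row L y) (row L (suc y) 0) (row L (suc y)))
lemma3p9 φ N L W no-req = mk⇔
  (λ (C , H , F) → from rows⇔local (compass-homogeneous-fulfilling⇒local-succ W C H F))
  (λ rows → let S = to rows⇔local rows in
     local-succ⇒compass W S , local-succ⇒homogeneous S , local-succ⇒fulfilling no-req S)
  where
  open Structure φ N L
  rows⇔local = rows-succ⇔local-succ φ N L
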